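{- Let $p,q$ be distinct primes $\ge 3$ and $m=pq$. Let $\mathcal{H}_p\subset\mathbb{Z}$ and $\mathcal{H}_q\subset\mathbb{Z}$ be as described in the context, let $k\in\mathcal{H}_p$ and $l\in\mathcal{H}_q$. Then $C_k\cap C'_l\neq\emptyset$.
   Context: Let $m'=\lfloor m/2\rfloor$. For an integer $a\not\equiv 0\pmod m$, $a_{red}$ is the unique integer in $\{1,\dots,m'\}$ with $a_{red}\equiv\pm a\pmod m$. $\mathcal{H}_p$ is a set of integers such that: every $k\in\mathcal{H}_p$ satisfies $\gcd(k,q)=1$; for every $j\in\{1,\dots,(p-1)/2\}$ there is $k\in\mathcal{H}_p$ with $k\equiv j\pmod p$; and $k\not\equiv\pm k'\pmod p$ for distinct $k,k'\in\mathcal{H}_p$. Symmetrically, $\mathcal{H}_q$ is a set of integers such that every $l\in\mathcal{H}_q$ satisfies $\gcd(l,p)=1$; for every $j\in\{1,\dots,(q-1)/2\}$ there is $l\in\mathcal{H}_q$ with $l\equiv j\pmod q$; and $l\not\equiv\pm l'\pmod q$ for distinct $l,l'\in\mathcal{H}_q$. For $k\in\mathcal{H}_p$ let $C_k=\{(kj)_{red}:\ j\in\{1,\dots,m\},\ j\equiv1\pmod p,\ \gcd(j,q)=1\}$, and for $l\in\mathcal{H}_q$ let $C'_l=\{(lj)_{red}:\ j\in\{1,\dots,m\},\ j\equiv1\pmod q,\ \gcd(j,p)=1\}$. -}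

module Defs where

open import Data.Nat as ℕ using (ℕ; zero; suc; _≤_; _≤ᵇ_; _∸_; _/_)
open import Data.Nat.GCD using (gcd)
open import Data.Integer as ℤ using (ℤ; +_; -_; ∣_∣; _%ℕ_)
open import Data.Integer.Divisibility using () renaming (_∣_ to _∣ℤ_)
open import Data.Bool using (if_then_else_)
open import Data.Product using (Σ; _×_)
open import Data.Sum using (_⊎_)
open import Relation.Binary.PropositionalEquality using (_≡_; _≢_)
open import Relation.Nullary using (¬_)

_≡_[mod_] : ℤ → ℤ → ℕ → Set
a ≡ b [mod n ] = (+ n) ∣ℤ (a ℤ.- b)

-- a_red for modulus m : the residue r ∈ {0,…,m-1} of a if r ≤ ⌊m/2⌋, else m - r.
-- For a ≢ 0 (mod m) this is the unique element of {1,…,⌊m/2⌋} congruent to ±a.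
red : ℤ → ℕ → ℕ
red a zero = 0
red a (suc n) =
  let r = a %ℕ suc n in
  if r ≤ᵇ (suc n / 2) then r else suc n ∸ r

-- x ∈ C-set m a b k  iff  x = (k j)_red (mod m) for some j ∈ {1,…,m}
-- with j ≡ 1 (mod a) and gcd(j,b) = 1.
-- C_k  = C-set (p*q) p q k ,   C'_l = C-set (p*q) q p l.
C-set : ℕ → ℕ → ℕ → ℤ → ℕ → Set
C-set m a b k x =
  Σ ℕ λ j → (1 ≤ j) × (j ≤ m) × ((+ j) ≡ (+ 1) [mod a ]) × (gcd j b ≡ 1)
            × (red (k ℤ.* (+ j)) m ≡ x)

IsHalfSystem : ℕ → ℕ → (ℤ → Set) → Set
IsHalfSystem a b H =
  (∀ k → H k → gcd ∣ k ∣ b ≡ 1)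
  × (∀ k → H k → Σ ℕ λ j → (1 ≤ j) × (j ≤ (a ∸ 1) / 2)
                          × (k ≡ (+ j) [mod a ] ⊎ k ≡ (- (+ j)) [mod a ]))
  × (∀ j → 1 ≤ j → j ≤ (a ∸ 1) / 2 → Σ ℤ λ k → H k × (k ≡ (+ j) [mod a ]))
  × (∀ k k' → H k → H k' → k ≢ k'
       → ¬ (k ≡ k' [mod a ]) × ¬ (k ≡ (- k') [mod a ]))

{-# OPTIONS --safe #-}
-- By the Chinese remainder theorem there is J ≡ 1 (mod p) with kJ ≡ l (mod q), and
-- symmetrically J′ ≡ 1 (mod q) with lJ′ ≡ k (mod p).  Then kJ and lJ′ are both ≡ k
-- modulo p and both ≡ l modulo q, hence congruent modulo m = pq, so (kJ)_red = (lJ′)_red.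
-- Reducing J modulo m gives an admissible index for C_k: it stays ≡ 1 (mod p), and it is
-- prime to q because q ∤ l; likewise for J′ and C′_l.
module Submission where

open import Defs

open import Data.Integer.Base using (ℤ; +_; -[1+_]; -_; _+_; _-_; _*_; ∣_∣; 0ℤ; 1ℤ; _%ℕ_; _/ℕ_)
import Data.Integer.Properties as ℤ
open import Data.Integer.DivMod using (a≡a%ℕn+[a/ℕn]*n; n%ℕd<d)
open import Data.Integer.Divisibility.Signed
  using (divides; ∣ᵤ⇒∣; ∣⇒∣ᵤ; ∣m∣n⇒∣m+n; ∣m⇒∣-m; ∣m⇒∣m*n; ∣n⇒∣m*n)
  renaming (_∣_ to _∣ℤ_)
open import Data.Integer.Tactic.RingSolver using (solve)
open import Data.Bool.Base using (if_then_else_)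
open import Data.List.Base using (_∷_; [])
open import Data.Nat.Base as ℕ using (ℕ; zero; suc; NonZero; _≤_; _<_; _∸_; _/_; s≤s; >-nonZero)
import Data.Nat.Properties as ℕ
open import Data.Nat.Divisibility using (_∣_; _∤_; ∣-trans; ∣1⇒≡1; >⇒∤; m∣m*n; n∣m*n)
open import Data.Nat.DivMod using (m/n≤m)
open import Data.Nat.GCD using (gcd; module Bézout)
open import Data.Nat.LCM using (lcm; lcm-least; gcd*lcm)
open import Data.Nat.Coprimality as Coprime using (Coprime; coprime⇒gcd≡1; gcd≡1⇒coprime; coprime-Bézout)
open import Data.Nat.Primality using (Prime; prime⇒irreducible; prime⇒nonZero; ¬prime[1])
open import Data.Product using (Σ; ∃; _×_; _,_; proj₁)
open import Data.Sum using (_⊎_; inj₁; inj₂)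
open import Level using (0ℓ)
open import Relation.Binary.Bundles using (Setoid)
open import Relation.Binary.Structures using (IsEquivalence)
open import Relation.Binary.PropositionalEquality
  using (_≡_; _≢_; refl; sym; trans; cong; cong₂; subst; module ≡-Reasoning)
open import Relation.Nullary using (¬_; contradiction)

-- The congruence of Defs hides a and b under ∣_∣, so unification cannot recover them;
-- this record keeps them as indices.
infix 4 _≡_⟨mod_⟩
record _≡_⟨mod_⟩ (a b : ℤ) (n : ℕ) : Set where
  constructor mod-by
  field
    modulus∣difference : + n ∣ℤ (a - b)

module _ {n : ℕ} where

  ⟨mod⟩⇒[mod] : ∀ {a b} → a ≡ b ⟨mod n ⟩ → a ≡ b [mod n ]
  ⟨mod⟩⇒[mod] (mod-by n∣a-b) = ∣⇒∣ᵤ n∣a-b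

  [mod]⇒⟨mod⟩ : ∀ {a b} → a ≡ b [mod n ] → a ≡ b ⟨mod n ⟩
  [mod]⇒⟨mod⟩ {a} {b} a≡b = mod-by (∣ᵤ⇒∣ {+ n} {a - b} a≡b)

  ≡⟨mod⟩-via : ∀ {a b} c → a - b ≡ c → + n ∣ℤ c → a ≡ b ⟨mod n ⟩
  ≡⟨mod⟩-via _ refl n∣c = mod-by n∣c

  ≡⟨mod⟩-refl : ∀ {a} → a ≡ a ⟨mod n ⟩
  ≡⟨mod⟩-refl {a} = ≡⟨mod⟩-via 0ℤ (ℤ.+-inverseʳ a) (divides 0ℤ refl)

  ≡⟨mod⟩-sym : ∀ {a b} → a ≡ b ⟨mod n ⟩ → b ≡ a ⟨mod n ⟩
  ≡⟨mod⟩-sym {a} {b} (mod-by n∣a-b) =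
    ≡⟨mod⟩-via (- (a - b)) (solve (a ∷ b ∷ [])) (∣m⇒∣-m n∣a-b)

  ≡⟨mod⟩-trans : ∀ {a b c} → a ≡ b ⟨mod n ⟩ → b ≡ c ⟨mod n ⟩ → a ≡ c ⟨mod n ⟩
  ≡⟨mod⟩-trans {a} {b} {c} (mod-by n∣a-b) (mod-by n∣b-c) =
    ≡⟨mod⟩-via _ (sym (ℤ.+-minus-telescope a b c)) (∣m∣n⇒∣m+n n∣a-b n∣b-c)

  ≡⟨mod⟩-+-cong : ∀ {a b c d} → a ≡ b ⟨mod n ⟩ → c ≡ d ⟨mod n ⟩ → a + c ≡ b + d ⟨mod n ⟩
  ≡⟨mod⟩-+-cong {a} {b} {c} {d} (mod-by n∣a-b) (mod-by n∣c-d) =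
    ≡⟨mod⟩-via ((a - b) + (c - d)) (solve (a ∷ b ∷ c ∷ d ∷ [])) (∣m∣n⇒∣m+n n∣a-b n∣c-d)

  ≡⟨mod⟩-*-cong : ∀ {a b c d} → a ≡ b ⟨mod n ⟩ → c ≡ d ⟨mod n ⟩ → a * c ≡ b * d ⟨mod n ⟩
  ≡⟨mod⟩-*-cong {a} {b} {c} {d} (mod-by n∣a-b) (mod-by n∣c-d) =
    ≡⟨mod⟩-via ((a - b) * c + b * (c - d)) (solve (a ∷ b ∷ c ∷ d ∷ []))
      (∣m∣n⇒∣m+n (∣m⇒∣m*n c n∣a-b) (∣n⇒∣m*n b n∣c-d))

  ≡⟨mod⟩-multiple : ∀ a → a * + n ≡ 0ℤ ⟨mod n ⟩
  ≡⟨mod⟩-multiple a = ≡⟨mod⟩-via (a * + n) (ℤ.+-identityʳ (a * + n)) (divides a refl)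

  ∣⇒≡0⟨mod⟩ : ∀ {j} → n ∣ j → + j ≡ 0ℤ ⟨mod n ⟩
  ∣⇒≡0⟨mod⟩ {j} n∣j = [mod]⇒⟨mod⟩ (subst (n ∣_) (cong ∣_∣ (sym (ℤ.+-identityʳ (+ j)))) n∣j)

  ≡0⟨mod⟩⇒∣ : ∀ {a} → a ≡ 0ℤ ⟨mod n ⟩ → n ∣ ∣ a ∣
  ≡0⟨mod⟩⇒∣ {a} a≡0 = subst (n ∣_) (cong ∣_∣ (ℤ.+-identityʳ a)) (⟨mod⟩⇒[mod] a≡0)

  ≡⟨mod⟩-isEquivalence : IsEquivalence (_≡_⟨mod n ⟩)
  ≡⟨mod⟩-isEquivalence = record { refl = ≡⟨mod⟩-refl ; sym = ≡⟨mod⟩-sym ; trans = ≡⟨mod⟩-trans }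

≡⟨mod⟩-setoid : ℕ → Setoid 0ℓ 0ℓ
≡⟨mod⟩-setoid n = record { isEquivalence = ≡⟨mod⟩-isEquivalence {n} }

module ≡⟨mod⟩-Reasoning (n : ℕ) where
  open import Relation.Binary.Reasoning.Setoid (≡⟨mod⟩-setoid n) public

coprime⇒lcm≡* : ∀ {m n} → Coprime m n → lcm m n ≡ m ℕ.* n
coprime⇒lcm≡* {m} {n} m⊥n = begin
  lcm m n             ≡⟨ ℕ.*-identityˡ (lcm m n) ⟨
  1 ℕ.* lcm m n       ≡⟨ cong (ℕ._* lcm m n) (coprime⇒gcd≡1 m⊥n) ⟨
  gcd m n ℕ.* lcm m n ≡⟨ gcd*lcm m n ⟩
  m ℕ.* n             ∎
  where open ≡-Reasoning

≡⟨mod⟩-∣ : ∀ {d n a b} → d ∣ n → a ≡ b ⟨mod n ⟩ → a ≡ b ⟨mod d ⟩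
≡⟨mod⟩-∣ d∣n a≡b = [mod]⇒⟨mod⟩ (∣-trans d∣n (⟨mod⟩⇒[mod] a≡b))

≡⟨mod⟩-combine : ∀ {m n a b} → Coprime m n →
                 a ≡ b ⟨mod m ⟩ → a ≡ b ⟨mod n ⟩ → a ≡ b ⟨mod m ℕ.* n ⟩
≡⟨mod⟩-combine m⊥n a≡b[m] a≡b[n] = [mod]⇒⟨mod⟩
  (subst (_∣ _) (coprime⇒lcm≡* m⊥n) (lcm-least (⟨mod⟩⇒[mod] a≡b[m]) (⟨mod⟩⇒[mod] a≡b[n])))

%ℕ-≡⟨mod⟩ : ∀ a n .{{_ : NonZero n}} → + (a %ℕ n) ≡ a ⟨mod n ⟩
%ℕ-≡⟨mod⟩ a n = ≡⟨mod⟩-sym (begin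
  a                       ≡⟨ a≡a%ℕn+[a/ℕn]*n a n ⟩
  r + a /ℕ n * + n        ≈⟨ ≡⟨mod⟩-+-cong (≡⟨mod⟩-refl {a = r}) (≡⟨mod⟩-multiple (a /ℕ n)) ⟩
  r + 0ℤ                  ≡⟨ ℤ.+-identityʳ r ⟩
  r                       ∎)
  where
  r = + (a %ℕ n)
  open ≡⟨mod⟩-Reasoning n

∣∧<⇒≡0 : ∀ {n x} → n ∣ x → x < n → x ≡ 0
∣∧<⇒≡0 {x = zero}  _   _   = refl
∣∧<⇒≡0 {x = suc _} n∣x x<n = contradiction n∣x (>⇒∤ x<n)

≤∧≡⟨mod⟩⇒≡ : ∀ {n r s} → r ≤ s → s < n → + r ≡ + s ⟨mod n ⟩ → r ≡ s
≤∧≡⟨mod⟩⇒≡ {n} {r} {s} r≤s s<n r≡s =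
  ℕ.≤-antisym r≤s (ℕ.m∸n≡0⇒m≤n (∣∧<⇒≡0 n∣s∸r (ℕ.≤-<-trans (ℕ.m∸n≤m s r) s<n)))
  where
  n∣s∸r : n ∣ s ∸ r
  n∣s∸r = subst (n ∣_) (trans (cong ∣_∣ (ℤ.m-n≡m⊖n r s)) (ℤ.∣⊖∣-≤ r≤s)) (⟨mod⟩⇒[mod] r≡s)

<∧≡⟨mod⟩⇒≡ : ∀ {n r s} → r < n → s < n → + r ≡ + s ⟨mod n ⟩ → r ≡ s
<∧≡⟨mod⟩⇒≡ {r = r} {s} r<n s<n r≡s with ℕ.≤-total r s
... | inj₁ r≤s = ≤∧≡⟨mod⟩⇒≡ r≤s s<n r≡s
... | inj₂ s≤r = sym (≤∧≡⟨mod⟩⇒≡ s≤r r<n (≡⟨mod⟩-sym r≡s))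

%ℕ-cong : ∀ {a b} n .{{_ : NonZero n}} → a ≡ b ⟨mod n ⟩ → a %ℕ n ≡ b %ℕ n
%ℕ-cong {a} {b} n a≡b = <∧≡⟨mod⟩⇒≡ (n%ℕd<d a n) (n%ℕd<d b n)
  (≡⟨mod⟩-trans (%ℕ-≡⟨mod⟩ a n) (≡⟨mod⟩-trans a≡b (≡⟨mod⟩-sym (%ℕ-≡⟨mod⟩ b n))))

red-cong : ∀ {a b} m → a ≡ b ⟨mod m ⟩ → red a m ≡ red b m
red-cong zero    _   = refl
red-cong (suc n) a≡b =
  cong (λ r → if r ℕ.≤ᵇ suc n / 2 then r else suc n ∸ r) (%ℕ-cong (suc n) a≡b)

prime∤⇒coprime : ∀ {p n} → Prime p → p ∤ n → Coprime n p
prime∤⇒coprime p-prime p∤n (d∣n , d∣p) with prime⇒irreducible p-prime d∣p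
... | inj₁ d≡1  = d≡1
... | inj₂ refl = contradiction d∣n p∤n

distinct-primes⇒coprime : ∀ {p q} → Prime p → Prime q → p ≢ q → Coprime p q
distinct-primes⇒coprime {p} {q} p-prime q-prime p≢q = prime∤⇒coprime q-prime q∤p
  where
  q∤p : q ∤ p
  q∤p q∣p with prime⇒irreducible p-prime q∣p
  ... | inj₁ q≡1 = ¬prime[1] (subst Prime q≡1 q-prime)
  ... | inj₂ q≡p = p≢q (sym q≡p)

coprime⇒inverse-ℕ : ∀ {m n} → Coprime m n → ∃ λ u → u * + m ≡ 1ℤ ⟨mod n ⟩
coprime⇒inverse-ℕ {m} {n} m⊥n with coprime-Bézout m⊥n
... | Bézout.+- x y 1+yn≡xm = + x , ≡⟨mod⟩-via (+ y * + n) xm-1≡yn (divides (+ y) refl)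
  where
  xm-1≡yn : + x * + m - 1ℤ ≡ + y * + n
  xm-1≡yn = begin
    + x * + m - 1ℤ             ≡⟨ cong (_- 1ℤ) (ℤ.pos-* x m) ⟨
    + (x ℕ.* m) - 1ℤ           ≡⟨ cong (λ t → + t - 1ℤ) 1+yn≡xm ⟨
    + (1 ℕ.+ y ℕ.* n) - 1ℤ     ≡⟨ ℤ.pos-* y n ⟩
    + y * + n                  ∎
    where open ≡-Reasoning
... | Bézout.-+ x y 1+xm≡yn = - + x , ≡⟨mod⟩-via ((- + y) * + n) -xm-1≡-yn (divides (- + y) refl)
  where
  -xm-1≡-yn : (- + x) * + m - 1ℤ ≡ (- + y) * + n
  -xm-1≡-yn = begin
    (- + x) * + m - 1ℤ         ≡⟨ rearrange (+ x) (+ m) ⟩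
    - (1ℤ + + x * + m)         ≡⟨ cong (λ t → - (1ℤ + t)) (ℤ.pos-* x m) ⟨
    - + (1 ℕ.+ x ℕ.* m)        ≡⟨ cong (λ t → - + t) 1+xm≡yn ⟩
    - + (y ℕ.* n)              ≡⟨ cong -_ (ℤ.pos-* y n) ⟩
    - (+ y * + n)              ≡⟨ ℤ.neg-distribˡ-* (+ y) (+ n) ⟩
    (- + y) * + n              ∎
    where
    open ≡-Reasoning
    rearrange : ∀ i j → (- i) * j - 1ℤ ≡ - (1ℤ + i * j)
    rearrange i j = solve (i ∷ j ∷ [])

coprime⇒inverse : ∀ a {n} → Coprime ∣ a ∣ n → ∃ λ u → u * a ≡ 1ℤ ⟨mod n ⟩
coprime⇒inverse (+ m)    a⊥n = coprime⇒inverse-ℕ a⊥n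
coprime⇒inverse -[1+ m ] a⊥n with coprime⇒inverse-ℕ a⊥n
... | u , u*m≡1 = - u , subst (_≡ 1ℤ ⟨mod _ ⟩) (neg-both u (+ suc m)) u*m≡1
  where
  neg-both : ∀ i j → i * j ≡ (- i) * (- j)
  neg-both i j = solve (i ∷ j ∷ [])

chinese-remainder : ∀ {m n} → Coprime m n → ∀ r s → ∃ λ x → x ≡ r ⟨mod m ⟩ × x ≡ s ⟨mod n ⟩
chinese-remainder {m} {n} m⊥n r s
  with coprime⇒inverse (+ n) (Coprime.sym m⊥n) | coprime⇒inverse (+ m) m⊥n
... | v , v*n≡1 | u , u*m≡1 = r * (v * + n) + s * (u * + m) , x≡r , x≡s
  where
  x≡r : r * (v * + n) + s * (u * + m) ≡ r ⟨mod m ⟩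
  x≡r = begin
    r * (v * + n) + s * (u * + m)  ≈⟨ ≡⟨mod⟩-+-cong (≡⟨mod⟩-*-cong (≡⟨mod⟩-refl {a = r}) v*n≡1)
                                                      (≡⟨mod⟩-*-cong (≡⟨mod⟩-refl {a = s}) (≡⟨mod⟩-multiple u)) ⟩
    r * 1ℤ + s * 0ℤ                ≡⟨ cong₂ _+_ (ℤ.*-identityʳ r) (ℤ.*-zeroʳ s) ⟩
    r + 0ℤ                         ≡⟨ ℤ.+-identityʳ r ⟩
    r                              ∎
    where open ≡⟨mod⟩-Reasoning m
  x≡s : r * (v * + n) + s * (u * + m) ≡ s ⟨mod n ⟩
  x≡s = begin
    r * (v * + n) + s * (u * + m)  ≈⟨ ≡⟨mod⟩-+-cong (≡⟨mod⟩-*-cong (≡⟨mod⟩-refl {a = r}) (≡⟨mod⟩-multiple v))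
                                                      (≡⟨mod⟩-*-cong (≡⟨mod⟩-refl {a = s}) u*m≡1) ⟩
    r * 0ℤ + s * 1ℤ                ≡⟨ cong₂ _+_ (ℤ.*-zeroʳ r) (ℤ.*-identityʳ s) ⟩
    0ℤ + s                         ≡⟨ ℤ.+-identityˡ s ⟩
    s                              ∎
    where open ≡⟨mod⟩-Reasoning n

∃-index : ∀ {m n} → Coprime m n → ∀ k l → Coprime ∣ k ∣ n →
          ∃ λ j → j ≡ 1ℤ ⟨mod m ⟩ × k * j ≡ l ⟨mod n ⟩
∃-index {m} {n} m⊥n k l k⊥n =
  let (u , u*k≡1) = coprime⇒inverse k k⊥n
      (j , j≡1 , j≡u*l) = chinese-remainder m⊥n 1ℤ (u * l)
      open ≡⟨mod⟩-Reasoning n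
  in j , j≡1 , (begin
    k * j        ≈⟨ ≡⟨mod⟩-*-cong (≡⟨mod⟩-refl {a = k}) j≡u*l ⟩
    k * (u * l)  ≡⟨ ℤ.*-assoc k u l ⟨
    k * u * l    ≡⟨ cong (_* l) (ℤ.*-comm k u) ⟩
    u * k * l    ≈⟨ ≡⟨mod⟩-*-cong u*k≡1 (≡⟨mod⟩-refl {a = l}) ⟩
    1ℤ * l       ≡⟨ ℤ.*-identityˡ l ⟩
    l            ∎)

≤half⇒< : ∀ {a i} → 1 ≤ i → i ≤ (a ∸ 1) / 2 → i < a
≤half⇒< {zero}  (s≤s _) ()
≤half⇒< {suc a} _   i≤a/2 = s≤s (ℕ.≤-trans i≤a/2 (m/n≤m a 2))

halfSystem⇒≢0 : ∀ {a b H k} → IsHalfSystem a b H → H k → ¬ k ≡ 0ℤ ⟨mod a ⟩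
halfSystem⇒≢0 {a} {k = k} (_ , represented , _) k∈H k≡0 with represented k k∈H
... | i , 1≤i , i≤a/2 , k≡±i = >⇒∤ {{>-nonZero 1≤i}} (≤half⇒< 1≤i i≤a/2) (a∣i k≡±i)
  where
  a∣i : k ≡ + i [mod a ] ⊎ k ≡ - + i [mod a ] → a ∣ i
  a∣i (inj₁ k≡i)  = ≡0⟨mod⟩⇒∣ (≡⟨mod⟩-trans (≡⟨mod⟩-sym ([mod]⇒⟨mod⟩ k≡i)) k≡0)
  a∣i (inj₂ k≡-i) = subst (a ∣_) (ℤ.∣-i∣≡∣i∣ (+ i))
    (≡0⟨mod⟩⇒∣ (≡⟨mod⟩-trans (≡⟨mod⟩-sym ([mod]⇒⟨mod⟩ k≡-i)) k≡0))

*-≡1⟨mod⟩ : ∀ {n} a {b} → b ≡ 1ℤ ⟨mod n ⟩ → a * b ≡ a ⟨mod n ⟩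
*-≡1⟨mod⟩ {n} a {b} b≡1 =
  subst ((a * b) ≡_⟨mod n ⟩) (ℤ.*-identityʳ a) (≡⟨mod⟩-*-cong (≡⟨mod⟩-refl {a = a}) b≡1)

factor≢0⟨mod⟩ : ∀ {n} k {j l} → k * j ≡ l ⟨mod n ⟩ → ¬ l ≡ 0ℤ ⟨mod n ⟩ → ¬ j ≡ 0ℤ ⟨mod n ⟩
factor≢0⟨mod⟩ {n} k {j} {l} k*j≡l l≢0 j≡0 = l≢0 (begin
  l       ≈⟨ k*j≡l ⟨
  k * j   ≈⟨ ≡⟨mod⟩-*-cong (≡⟨mod⟩-refl {a = k}) j≡0 ⟩
  k * 0ℤ  ≡⟨ ℤ.*-zeroʳ k ⟩
  0ℤ      ∎)
  where open ≡⟨mod⟩-Reasoning n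

∈C-set : ∀ {m a b} .{{_ : NonZero m}} → Prime a → Prime b → a ∣ m → b ∣ m →
         ∀ k J → J ≡ 1ℤ ⟨mod a ⟩ → ¬ J ≡ 0ℤ ⟨mod b ⟩ → C-set m a b k (red (k * J) m)
∈C-set {m} {a} {b} a-prime b-prime a∣m b∣m k J J≡1 J≢0 =
  j , ℕ.n≢0⇒n>0 j≢0 , ℕ.<⇒≤ (n%ℕd<d J m) , ⟨mod⟩⇒[mod] j≡1 ,
  coprime⇒gcd≡1 (prime∤⇒coprime b-prime b∤j) ,
  red-cong m (≡⟨mod⟩-*-cong (≡⟨mod⟩-refl {a = k}) j≡J)
  where
  j = J %ℕ m
  j≡J : + j ≡ J ⟨mod m ⟩
  j≡J = %ℕ-≡⟨mod⟩ J m
  j≡1 : + j ≡ 1ℤ ⟨mod a ⟩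
  j≡1 = ≡⟨mod⟩-trans (≡⟨mod⟩-∣ a∣m j≡J) J≡1
  j≢0 : j ≢ 0
  j≢0 j≡0 = ¬prime[1] (subst Prime a≡1 a-prime)
    where
    a≡1 : a ≡ 1
    a≡1 = ∣1⇒≡1 (⟨mod⟩⇒[mod] (subst (λ i → + i ≡ 1ℤ ⟨mod a ⟩) j≡0 j≡1))
  b∤j : b ∤ j
  b∤j b∣j = J≢0 (≡⟨mod⟩-trans (≡⟨mod⟩-sym (≡⟨mod⟩-∣ b∣m j≡J)) (∣⇒≡0⟨mod⟩ b∣j))

lemma1 : (p q : ℕ) → Prime p → Prime q → 3 ≤ p → 3 ≤ q → p ≢ q
    → (Hp Hq : ℤ → Set) → IsHalfSystem p q Hp → IsHalfSystem q p Hq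
    → (k l : ℤ) → Hp k → Hq l
    → Σ ℕ λ x → C-set (p ℕ.* q) p q k x × C-set (p ℕ.* q) q p l x
lemma1 p q p-prime q-prime _ _ p≢q Hp Hq Hp-half Hq-half k l k∈Hp l∈Hq =
  let (J , J≡1 , kJ≡l)  = ∃-index p⊥q k l (gcd≡1⇒coprime (proj₁ Hp-half k k∈Hp))
      (J′ , J′≡1 , lJ′≡k) = ∃-index (Coprime.sym p⊥q) l k (gcd≡1⇒coprime (proj₁ Hq-half l l∈Hq))
      lJ′≡kJ : l * J′ ≡ k * J ⟨mod p ℕ.* q ⟩
      lJ′≡kJ = ≡⟨mod⟩-combine p⊥q
        (≡⟨mod⟩-trans lJ′≡k (≡⟨mod⟩-sym (*-≡1⟨mod⟩ k J≡1)))
        (≡⟨mod⟩-trans (*-≡1⟨mod⟩ l J′≡1) (≡⟨mod⟩-sym kJ≡l))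
  in red (k * J) (p ℕ.* q) ,
     ∈C-set p-prime q-prime (m∣m*n q) (n∣m*n p) k J J≡1
       (factor≢0⟨mod⟩ k kJ≡l (halfSystem⇒≢0 Hq-half l∈Hq)) ,
     subst (C-set (p ℕ.* q) q p l) (red-cong (p ℕ.* q) lJ′≡kJ)
       (∈C-set q-prime p-prime (n∣m*n p) (m∣m*n q) l J′ J′≡1
         (factor≢0⟨mod⟩ l lJ′≡k (halfSystem⇒≢0 Hp-half k∈Hp)))
  where
  p⊥q : Coprime p q
  p⊥q = distinct-primes⇒coprime p-prime q-prime p≢q
  instance
    pq≢0 : NonZero (p ℕ.* q)
    pq≢0 = ℕ.m*n≢0 p q {{prime⇒nonZero p-prime}} {{prime⇒nonZero q-prime}}
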